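{- Let $\Psi\in\{\mathfrak F,\mathfrak B\}$, let $\alpha,\beta$ satisfy $2<\alpha\le 3$ and $4\alpha-\beta=6$, and let $G\in\mathcal G(\Psi,\alpha,\beta)$. If $(M,L,R)$ is a separation of $G$ with $|M|\ge 3$ and $q_{\alpha,\beta}(G|_M)\ge 0$, then $G|_{L\cup M}$ or $G|_{R\cup M}$ has a $\Psi$-cut.
   Context: All graphs are finite and simple. $|G|$ is the number of vertices, $e(G)$ the number of edges, $G|_X$ the subgraph induced on $X$. $q_{\alpha,\beta}(G)=\alpha|G|-e(G)-\beta$. $\mathfrak F$ is the class of forests and $\mathfrak B$ the class of bipartite graphs. A vertex cut is a vertex set whose removal disconnects the graph; a $\Psi$-cut of $G$ is a vertex cut $M$ with $G|_M\in\Psi$. $\mathcal G(\Psi,\alpha,\beta)$ is the set of graphs $G$ such that $|G|\ge4$, $q_{\alpha,\beta}(G)>0$, $G$ has no $\Psi$-cut, and $G$ has the smallest number of vertices among all graphs with these three properties. A separation of $G$ is a triple $(M,L,R)$ with $V(G)=M\sqcup L\sqcup R$, $L,R$ nonempty, and no edges between $L$ and $R$. -}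

module Defs where

open import Level using (0ℓ)
open import Data.Bool using (Bool; true; false; _∧_; if_then_else_)
open import Data.Nat as ℕ using (ℕ; suc; _<ᵇ_)
open import Data.Integer as ℤ using (ℤ; +_; +[1+_]; -[1+_]; _-_)
open import Data.Rational as ℚ using (ℚ; _/_; _<_)
open import Data.Fin using (Fin; toℕ)
open import Data.Fin.Subset using (Subset; _∈_; _∉_; _⊆_; _∩_; _∪_; _─_; ∣_∣; ⊤; ⊥; Nonempty)
open import Data.Nat.ListAction using (sum)
open import Data.List using (List; []; _∷_; length; map; allFin; take; _++_)
open import Data.List.Relation.Unary.All using (All)
open import Data.List.Relation.Unary.Unique.Propositional using (Unique)
open import Data.List.Relation.Unary.Linked using (Linked)
open import Data.Vec using (lookup)
open import Data.Product using (Σ; ∃; ∃-syntax; _×_)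
open import Data.Sum using (_⊎_)
open import Relation.Nullary using (¬_)
open import Relation.Binary.PropositionalEquality using (_≡_)

-- Real numbers as two-sided Dedekind cuts of ℚ
-- (agda-stdlib has no reals; α only ever gets compared with rationals)

record ℝ : Set₁ where
  field
    Lo Up      : ℚ → Set
    Lo-inhab   : ∃ λ p → Lo p
    Up-inhab   : ∃ λ p → Up p
    Lo-lower   : ∀ {p q} → p < q → Lo q → Lo p
    Up-upper   : ∀ {p q} → p < q → Up p → Up q
    Lo-round   : ∀ {p} → Lo p → ∃ λ q → p < q × Lo q
    Up-round   : ∀ {q} → Up q → ∃ λ p → p < q × Up p
    disjoint   : ∀ {p} → ¬ (Lo p × Up p)
    located    : ∀ {p q} → p < q → Lo p ⊎ Up q
open ℝ public

_<ℝ_ : ℚ → ℝ → Set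
x <ℝ α = Lo α x

_≤ℝ_ : ℝ → ℚ → Set
α ≤ℝ x = ¬ (Lo α x)

-- α·k + c > 0, for integers k, c
LinPos : ℝ → ℤ → ℤ → Set
LinPos α (+ 0)     c = ℤ.0ℤ ℤ.< c
LinPos α +[1+ k ]  c = Lo α ((ℤ.- c) / suc k)
LinPos α -[1+ k ]  c = Up α (c / suc k)

-- α·k + c ≥ 0  :=  ¬ (α·k + c < 0)  :=  ¬ (α·(-k) + (-c) > 0)
LinNonneg : ℝ → ℤ → ℤ → Set
LinNonneg α k c = ¬ LinPos α (ℤ.- k) (ℤ.- c)

record Graph : Set where
  field
    n     : ℕ
    adj   : Fin n → Fin n → Bool
    sym   : ∀ u v → adj u v ≡ adj v u
    irref : ∀ u → adj u u ≡ false
open Graph public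

∣_∣ᵥ : Graph → ℕ
∣ G ∣ᵥ = n G

Adj : (G : Graph) → Fin (n G) → Fin (n G) → Set
Adj G u v = adj G u v ≡ true

eIn : (G : Graph) → Subset (n G) → ℕ
eIn G X = sum (map (λ i → sum (map (λ j →
  if ((toℕ i <ᵇ toℕ j) ∧ adj G i j ∧ lookup X i ∧ lookup X j) then 1 else 0)
  (allFin (n G)))) (allFin (n G)))

e : Graph → ℕ
e G = eIn G ⊤

data Reach (G : Graph) (X : Subset (n G)) : Fin (n G) → Fin (n G) → Set where
  here : ∀ {u} → u ∈ X → Reach G X u u
  step : ∀ {u w v} → u ∈ X → Adj G u w → Reach G X w v → Reach G X u v

Disconnected : (G : Graph) → Subset (n G) → Set
Disconnected G X = ∃[ u ] ∃[ v ] (u ∈ X × v ∈ X × ¬ Reach G X u v)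

IsVertexCutIn : (G : Graph) → Subset (n G) → Subset (n G) → Set
IsVertexCutIn G Y C = C ⊆ Y × Disconnected G (Y ─ C)

HasCycle : (G : Graph) → Subset (n G) → Set
HasCycle G X = ∃ λ (vs : List (Fin (n G))) →
  Unique vs × 3 ℕ.≤ length vs × All (_∈ X) vs × Linked (Adj G) (vs ++ take 1 vs)

IsForest : (G : Graph) → Subset (n G) → Set
IsForest G X = ¬ HasCycle G X

IsBipartite : (G : Graph) → Subset (n G) → Set
IsBipartite G X = ∃ λ (c : Fin (n G) → Bool) →
  ∀ u v → u ∈ X → v ∈ X → Adj G u v → ¬ (c u ≡ c v)

data Class : Set where
  𝔉 𝔅 : Class

InΨ : Class → (G : Graph) → Subset (n G) → Set
InΨ 𝔉 = IsForest
InΨ 𝔅 = IsBipartite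

HasΨCutIn : Class → (G : Graph) → Subset (n G) → Set
HasΨCutIn Ψ G Y = ∃ λ C → IsVertexCutIn G Y C × InΨ Ψ G C

HasΨCut : Class → Graph → Set
HasΨCut Ψ G = HasΨCutIn Ψ G ⊤

-- q_{α,β}(G|_X) = α|X| - e(G|_X) - β,  with β = 4α - 6 substituted:
--   = α(|X| - 4) + (6 - e(G|_X))
qPosIn : ℝ → (G : Graph) → Subset (n G) → Set
qPosIn α G X = LinPos α (+ ∣ X ∣ - + 4) (+ 6 - + eIn G X)

qNonnegIn : ℝ → (G : Graph) → Subset (n G) → Set
qNonnegIn α G X = LinNonneg α (+ ∣ X ∣ - + 4) (+ 6 - + eIn G X)

Candidate : Class → ℝ → Graph → Set
Candidate Ψ α G = 4 ℕ.≤ ∣ G ∣ᵥ × qPosIn α G ⊤ × ¬ HasΨCut Ψ G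

In𝒢 : Class → ℝ → Graph → Set
In𝒢 Ψ α G = Candidate Ψ α G × ((H : Graph) → ∣ H ∣ᵥ ℕ.< ∣ G ∣ᵥ → ¬ Candidate Ψ α H)

IsSeparation : (G : Graph) → (M L R : Subset (n G)) → Set
IsSeparation G M L R =
  M ∩ L ≡ ⊥ × M ∩ R ≡ ⊥ × L ∩ R ≡ ⊥ × (M ∪ L) ∪ R ≡ ⊤ ×
  Nonempty L × Nonempty R × (∀ u v → u ∈ L → v ∈ R → ¬ Adj G u v)

module Submission where

-- Suppose neither G|_{L∪M} nor G|_{R∪M} has a Ψ-cut. Both sides have at least 4 vertices
-- (M has 3 and L, R are nonempty) and fewer than G, and a Ψ-cut of the graph induced on a
-- vertex set X is a Ψ-cut of G|_X, so the minimality of G forces q ≤ 0 on both sides. As no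
-- edge joins L to R, vertices and edges of G are counted by inclusion–exclusion over the two
-- sides, whose union is V(G) and whose intersection is M. Hence q is modular:
-- q(G) = q(G|_{L∪M}) + q(G|_{R∪M}) − q(G|_M) ≤ 0, contradicting q(G) > 0. Having a Ψ-cut is
-- decidable for finite graphs, which turns this contradiction into the disjunction.

open import Defs hiding (sym)
import Algebra.Properties.CommutativeMonoid.Sum as Sum
open import Data.Bool using (Bool; true; false; _∧_; _∨_; if_then_else_)
import Data.Bool.Properties as BoolP
open import Data.Bool.Properties using (∧-zeroʳ; ¬-not)
open import Data.Empty using (⊥-elim) renaming (⊥ to Empty)
open import Data.Fin using (Fin; zero; suc; toℕ; _≟_)
import Data.Fin.Properties as FinP
open import Data.Fin.Subset using (Subset; _∈_; _∉_; _⊆_; _∩_; _∪_; _─_; ∣_∣; ⊤; ⊥; ⁅_⁆)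
open import Data.Fin.Subset.Properties
  using ( _∈?_; _⊆?_; anySubset?; drop-there; ∈⊤; ∉⊥; x∈⁅x⁆; x∈p∩q⁺; x∈p∪q⁻; p⊆p∪q; q⊆p∪q
        ; p─q⊆p; x∈p∧x∉q⇒x∈p─q; x∈p∧x≢y⇒x∈p-y; x∈p⇒∣p-x∣<∣p∣; p⊂q⇒∣p∣<∣q∣; ∣⊤∣≡n
        ; ∩-comm; ∪-identityˡ; ∪-distribʳ-∩; ∪-idempotentCommutativeMonoid )
import Data.Integer.Properties as ℤP
open import Data.Integer.Tactic.RingSolver using (solve-∀)
open import Data.List as List using (List; []; _∷_; length; map; allFin; tabulate; _++_; take)
import Data.List.Properties as ListP
open import Data.List.Membership.Propositional.Properties using (∈-lookup)
open import Data.List.Relation.Unary.All as All using (All; []; _∷_; all?)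
import Data.List.Relation.Unary.All.Properties as AllP
open import Data.List.Relation.Unary.AllPairs using (_∷_)
open import Data.List.Relation.Unary.Linked using (Linked; linked?)
import Data.List.Relation.Unary.Linked.Properties as LinkedP
open import Data.List.Relation.Unary.Unique.Propositional using (Unique)
import Data.List.Relation.Unary.Unique.Propositional.Properties as UniqueP
open import Data.Nat as ℕ using (ℕ; zero; suc; z≤n; s≤s; _<ᵇ_)
open import Data.Nat.ListAction using () renaming (sum to sumˡ)
import Data.Nat.Properties as ℕP
open import Data.Product using (∃; _,_; _×_; proj₁; proj₂)
open import Data.Rational as ℚ using (_/_)
import Data.Rational.Properties as ℚP
import Data.Rational.Unnormalised as ℚᵘ
import Data.Rational.Unnormalised.Properties as ℚᵘP
open import Data.Sum using (_⊎_; inj₁; inj₂; [_,_]′)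
open import Data.Vec as Vec using ([]; _∷_; lookup; here; there)
import Data.Vec.Properties as VecP
open import Function using (_∘_)
open import Relation.Nullary using (¬_; Dec; yes; no)
open import Relation.Nullary.Decidable using (_×-dec_; _→-dec_; ¬?)
open import Relation.Unary using (Decidable)
open import Relation.Binary.PropositionalEquality

-- Affine functions of α and the modularity of q

module _ where

  open import Data.Integer using (ℤ; +_; +[1+_]; -[1+_]; _+_; _-_; _*_; -_; _<_; _≤_)

  toℚᵘ-/ : ∀ a k → ℚ.toℚᵘ (a / suc k) ℚᵘ.≃ ℚᵘ.mkℚᵘ a k
  toℚᵘ-/ a k = ℚP.toℚᵘ-fromℚᵘ (ℚᵘ.mkℚᵘ a k)

  /-<⇒*< : ∀ a b k l → a / suc k ℚ.< b / suc l → a * + suc l < b * + suc k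
  /-<⇒*< a b k l lt =
    ℚᵘP.drop-*<* (ℚᵘP.<-respʳ-≃ (toℚᵘ-/ b l) (ℚᵘP.<-respˡ-≃ (toℚᵘ-/ a k) (ℚP.toℚᵘ-mono-< lt)))

  /-≤⇒*≤ : ∀ a b k l → a / suc k ℚ.≤ b / suc l → a * + suc l ≤ b * + suc k
  /-≤⇒*≤ a b k l le =
    ℚᵘP.drop-*≤* (ℚᵘP.≤-respʳ-≃ (toℚᵘ-/ b l) (ℚᵘP.≤-respˡ-≃ (toℚᵘ-/ a k) (ℚP.toℚᵘ-mono-≤ le)))

  module _ (α : ℝ) where

    Lo-lower-≤ : ∀ {p q} → p ℚ.≤ q → Lo α q → Lo α p
    Lo-lower-≤ p≤q q∈Lo with Lo-round α q∈Lo
    ... | r , q<r , r∈Lo = Lo-lower α (ℚP.≤-<-trans p≤q q<r) r∈Lo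

    Up-upper-≤ : ∀ {p q} → p ℚ.≤ q → Up α p → Up α q
    Up-upper-≤ p≤q p∈Up with Up-round α p∈Up
    ... | r , r<p , r∈Up = Up-upper α (ℚP.<-≤-trans r<p p≤q) r∈Up

    Lo∧¬Lo⇒< : ∀ {p q} → Lo α p → ¬ Lo α q → p ℚ.< q
    Lo∧¬Lo⇒< p∈Lo q∉Lo = ℚP.≰⇒> (λ q≤p → q∉Lo (Lo-lower-≤ q≤p p∈Lo))

    Up∧¬Up⇒> : ∀ {p q} → Up α p → ¬ Up α q → q ℚ.< p
    Up∧¬Up⇒> p∈Up q∉Up = ℚP.≰⇒> (λ p≤q → q∉Up (Up-upper-≤ p≤q p∈Up))

    ¬Lo∧¬Up⇒≥ : ∀ {p q} → ¬ Lo α p → ¬ Up α q → q ℚ.≤ p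
    ¬Lo∧¬Up⇒≥ p∉Lo q∉Up = ℚP.≮⇒≥ (λ p<q → [ p∉Lo , q∉Up ]′ (located α p<q))

    -- In each sign case the hypotheses compare the roots −c/k with α; cross-multiplied and
    -- added, two of these comparisons contradict a ring identity.
    ¬LinPos-+-pos-pos : ∀ x y c₁ c₂ → ¬ LinPos α +[1+ x ] c₁ → ¬ LinPos α +[1+ y ] c₂ →
                        ¬ LinPos α (+[1+ x ] + +[1+ y ]) (c₁ + c₂)
    ¬LinPos-+-pos-pos x y c₁ c₂ ¬P₁ ¬P₂ P =
      ℤP.<-irrefl (identity c₁ c₂ (+ suc x) (+ suc y)) (ℤP.+-mono-< A B)
      where
      A = /-<⇒*< (- (c₁ + c₂)) (- c₁) _ x (Lo∧¬Lo⇒< P ¬P₁)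
      B = /-<⇒*< (- (c₁ + c₂)) (- c₂) _ y (Lo∧¬Lo⇒< P ¬P₂)
      identity : ∀ c₁ c₂ p q → (- (c₁ + c₂)) * p + (- (c₁ + c₂)) * q ≡ (- c₁) * (p + q) + (- c₂) * (p + q)
      identity = solve-∀

    ¬LinPos-+-pos-zero : ∀ x c₁ c₂ → ¬ LinPos α +[1+ x ] c₁ → ¬ LinPos α (+ 0) c₂ →
                         ¬ LinPos α (+[1+ x ] + + 0) (c₁ + c₂)
    ¬LinPos-+-pos-zero x c₁ c₂ ¬P₁ ¬P₂ P =
      ℤP.<-irrefl (identity c₁ c₂ (+ suc x)) (ℤP.+-mono-<-≤ A B)
      where
      A : (- (c₁ + c₂)) * + suc x < (- c₁) * + suc x
      A = subst (λ w → (- (c₁ + c₂)) * + suc x < (- c₁) * + suc w) (ℕP.+-identityʳ x)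
            (/-<⇒*< (- (c₁ + c₂)) (- c₁) _ x (Lo∧¬Lo⇒< P ¬P₁))
      B : c₂ * + suc x ≤ + 0 * + suc x
      B = ℤP.*-monoʳ-≤-nonNeg (+ suc x) (ℤP.≮⇒≥ ¬P₂)
      identity : ∀ c₁ c₂ p → (- (c₁ + c₂)) * p + c₂ * p ≡ (- c₁) * p + + 0 * p
      identity = solve-∀

    -- The sum of the slopes is abstracted so that its sign can be matched on.
    ¬LinPos-+-pos-neg : ∀ x y c₁ c₂ → ¬ LinPos α +[1+ x ] c₁ → ¬ LinPos α -[1+ y ] c₂ →
                        ∀ k → k ≡ +[1+ x ] + -[1+ y ] → ¬ LinPos α k (c₁ + c₂)
    ¬LinPos-+-pos-neg x y c₁ c₂ ¬P₁ ¬P₂ +[1+ z ] k≡ P =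
      ℤP.<-irrefl (trans (identity c₁ c₂ (+ suc x) (+ suc y))
                         (cong (λ w → (- c₁) * w + (- c₁) * + suc y) (sym k≡)))
                  (ℤP.+-mono-<-≤ A B)
      where
      A = /-<⇒*< (- (c₁ + c₂)) (- c₁) z x (Lo∧¬Lo⇒< P ¬P₁)
      B = /-≤⇒*≤ c₂ (- c₁) y x (¬Lo∧¬Up⇒≥ ¬P₁ ¬P₂)
      identity : ∀ c₁ c₂ p q → (- (c₁ + c₂)) * p + c₂ * p ≡ (- c₁) * (p - q) + (- c₁) * q
      identity = solve-∀
    ¬LinPos-+-pos-neg x y c₁ c₂ ¬P₁ ¬P₂ -[1+ z ] k≡ P =
      ℤP.<-irrefl (identity c₁ c₂ (+ suc x) (+ suc y)) (ℤP.+-mono-<-≤ A B)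
      where
      A : c₂ * (- (+ suc x - + suc y)) < (c₁ + c₂) * + suc y
      A = subst (λ w → c₂ * w < (c₁ + c₂) * + suc y) (cong -_ k≡) (/-<⇒*< c₂ (c₁ + c₂) y z (Up∧¬Up⇒> P ¬P₂))
      B = /-≤⇒*≤ c₂ (- c₁) y x (¬Lo∧¬Up⇒≥ ¬P₁ ¬P₂)
      identity : ∀ c₁ c₂ p q → c₂ * (- (p - q)) + c₂ * p ≡ (c₁ + c₂) * q + (- c₁) * q
      identity = solve-∀
    ¬LinPos-+-pos-neg x y c₁ c₂ ¬P₁ ¬P₂ (+ 0) k≡ P =
      ℤP.<-irrefl (identity c₁ c₂ (+ suc x)) (ℤP.+-mono-≤-< A B)
      where
      A : c₂ * + suc x ≤ (- c₁) * + suc x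
      A = subst (λ w → c₂ * + suc x ≤ (- c₁) * w) (sym (ℤP.i-j≡0⇒i≡j _ _ (sym k≡)))
            (/-≤⇒*≤ c₂ (- c₁) y x (¬Lo∧¬Up⇒≥ ¬P₁ ¬P₂))
      B : + 0 * + suc x < (c₁ + c₂) * + suc x
      B = ℤP.*-monoʳ-<-pos (+ suc x) P
      identity : ∀ c₁ c₂ p → c₂ * p + + 0 * p ≡ (- c₁) * p + (c₁ + c₂) * p
      identity = solve-∀

    ¬LinPos-+-zero-zero : ∀ c₁ c₂ → ¬ LinPos α (+ 0) c₁ → ¬ LinPos α (+ 0) c₂ → ¬ LinPos α (+ 0) (c₁ + c₂)
    ¬LinPos-+-zero-zero c₁ c₂ ¬P₁ ¬P₂ P = ℤP.<⇒≱ P (ℤP.+-mono-≤ (ℤP.≮⇒≥ ¬P₁) (ℤP.≮⇒≥ ¬P₂))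

    ¬LinPos-+-zero-neg : ∀ y c₁ c₂ → ¬ LinPos α (+ 0) c₁ → ¬ LinPos α -[1+ y ] c₂ →
                         ¬ LinPos α (+ 0 + -[1+ y ]) (c₁ + c₂)
    ¬LinPos-+-zero-neg y c₁ c₂ ¬P₁ ¬P₂ P =
      ℤP.<-irrefl (identity c₁ c₂ (+ suc y)) (ℤP.+-mono-<-≤ A B)
      where
      A = /-<⇒*< c₂ (c₁ + c₂) y y (Up∧¬Up⇒> P ¬P₂)
      B : c₁ * + suc y ≤ + 0 * + suc y
      B = ℤP.*-monoʳ-≤-nonNeg (+ suc y) (ℤP.≮⇒≥ ¬P₁)
      identity : ∀ c₁ c₂ q → c₂ * q + c₁ * q ≡ (c₁ + c₂) * q + + 0 * q
      identity = solve-∀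

    ¬LinPos-+-neg-neg : ∀ x y c₁ c₂ → ¬ LinPos α -[1+ x ] c₁ → ¬ LinPos α -[1+ y ] c₂ →
                        ¬ LinPos α (-[1+ x ] + -[1+ y ]) (c₁ + c₂)
    ¬LinPos-+-neg-neg x y c₁ c₂ ¬P₁ ¬P₂ P =
      ℤP.<-irrefl (identity c₁ c₂ (+ suc x) (+ suc y)) (ℤP.+-mono-< A B)
      where
      slope : + suc (suc (x ℕ.+ y)) ≡ + suc x + + suc y
      slope = cong (λ w → + suc w) (sym (ℕP.+-suc x y))
      A = subst (λ w → c₁ * w < (c₁ + c₂) * + suc x) slope (/-<⇒*< c₁ (c₁ + c₂) x _ (Up∧¬Up⇒> P ¬P₁))
      B = subst (λ w → c₂ * w < (c₁ + c₂) * + suc y) slope (/-<⇒*< c₂ (c₁ + c₂) y _ (Up∧¬Up⇒> P ¬P₂))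
      identity : ∀ c₁ c₂ p q → c₁ * (p + q) + c₂ * (p + q) ≡ (c₁ + c₂) * p + (c₁ + c₂) * q
      identity = solve-∀

    ¬LinPos-+-comm : ∀ k₁ k₂ c₁ c₂ → ¬ LinPos α (k₂ + k₁) (c₂ + c₁) → ¬ LinPos α (k₁ + k₂) (c₁ + c₂)
    ¬LinPos-+-comm k₁ k₂ c₁ c₂ = subst₂ (λ k c → ¬ LinPos α k c) (ℤP.+-comm k₂ k₁) (ℤP.+-comm c₂ c₁)

    ¬LinPos-+ : ∀ {k₁ c₁ k₂ c₂} → ¬ LinPos α k₁ c₁ → ¬ LinPos α k₂ c₂ → ¬ LinPos α (k₁ + k₂) (c₁ + c₂)
    ¬LinPos-+ {+[1+ x ]}  {c₁} {+[1+ y ]}  {c₂} ¬P₁ ¬P₂ = ¬LinPos-+-pos-pos x y c₁ c₂ ¬P₁ ¬P₂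
    ¬LinPos-+ {+[1+ x ]}  {c₁} {+ 0}       {c₂} ¬P₁ ¬P₂ = ¬LinPos-+-pos-zero x c₁ c₂ ¬P₁ ¬P₂
    ¬LinPos-+ {+[1+ x ]}  {c₁} { -[1+ y ]} {c₂} ¬P₁ ¬P₂ = ¬LinPos-+-pos-neg x y c₁ c₂ ¬P₁ ¬P₂ _ refl
    ¬LinPos-+ {+ 0}       {c₁} {+[1+ y ]}  {c₂} ¬P₁ ¬P₂ =
      ¬LinPos-+-comm (+ 0) +[1+ y ] c₁ c₂ (¬LinPos-+-pos-zero y c₂ c₁ ¬P₂ ¬P₁)
    ¬LinPos-+ {+ 0}       {c₁} {+ 0}       {c₂} ¬P₁ ¬P₂ = ¬LinPos-+-zero-zero c₁ c₂ ¬P₁ ¬P₂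
    ¬LinPos-+ {+ 0}       {c₁} { -[1+ y ]} {c₂} ¬P₁ ¬P₂ = ¬LinPos-+-zero-neg y c₁ c₂ ¬P₁ ¬P₂
    ¬LinPos-+ { -[1+ x ]} {c₁} {+[1+ y ]}  {c₂} ¬P₁ ¬P₂ =
      ¬LinPos-+-comm -[1+ x ] +[1+ y ] c₁ c₂ (¬LinPos-+-pos-neg y x c₂ c₁ ¬P₂ ¬P₁ _ refl)
    ¬LinPos-+ { -[1+ x ]} {c₁} {+ 0}       {c₂} ¬P₁ ¬P₂ =
      ¬LinPos-+-comm -[1+ x ] (+ 0) c₁ c₂ (¬LinPos-+-zero-neg x c₂ c₁ ¬P₂ ¬P₁)
    ¬LinPos-+ { -[1+ x ]} {c₁} { -[1+ y ]} {c₂} ¬P₁ ¬P₂ = ¬LinPos-+-neg-neg x y c₁ c₂ ¬P₁ ¬P₂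

  affine-modular : ∀ a b c d → a ℕ.+ d ≡ b ℕ.+ c → ∀ s →
    (+ a - s ≡ (+ b - s) + (+ c - s) + - (+ d - s)) × (s - + a ≡ (s - + b) + (s - + c) + - (s - + d))
  affine-modular a b c d a+d≡b+c s = from-difference (+ a) (+ b) (+ c) (+ d) a≡b+c-d
    where
    a≡b+c-d : + a ≡ (+ b + + c) - + d
    a≡b+c-d = begin
      + a                ≡⟨ cancel (+ a) (+ d) ⟩
      (+ a + + d) - + d  ≡⟨ cong (_- + d) (ℤP.pos-+ a d) ⟨
      + (a ℕ.+ d) - + d  ≡⟨ cong (λ x → + x - + d) a+d≡b+c ⟩
      + (b ℕ.+ c) - + d  ≡⟨ cong (_- + d) (ℤP.pos-+ b c) ⟩
      (+ b + + c) - + d  ∎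
      where
      open ≡-Reasoning
      cancel : ∀ x y → x ≡ (x + y) - y
      cancel = solve-∀
    from-difference : ∀ A B C D → A ≡ (B + C) - D →
      (A - s ≡ (B - s) + (C - s) + - (D - s)) × (s - A ≡ (s - B) + (s - C) + - (s - D))
    from-difference _ B C D refl = left B C D s , right B C D s
      where
      left : ∀ B C D s → ((B + C) - D) - s ≡ (B - s) + (C - s) + - (D - s)
      left = solve-∀
      right : ∀ B C D s → s - ((B + C) - D) ≡ (s - B) + (s - C) + - (s - D)
      right = solve-∀

  qPosIn-modular : ∀ α G (Y M X₁ X₂ : Subset (n G)) →
    ∣ Y ∣ ℕ.+ ∣ M ∣ ≡ ∣ X₁ ∣ ℕ.+ ∣ X₂ ∣ → eIn G Y ℕ.+ eIn G M ≡ eIn G X₁ ℕ.+ eIn G X₂ →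
    qPosIn α G Y → ¬ qPosIn α G X₁ → ¬ qPosIn α G X₂ → ¬ qNonnegIn α G M
  qPosIn-modular α G Y M X₁ X₂ vertices edges qY ¬q₁ ¬q₂ qM =
    ¬LinPos-+ α {k X₁ + k X₂} {c X₁ + c X₂} { - k M} { - c M}
      (¬LinPos-+ α {k X₁} {c X₁} {k X₂} {c X₂} ¬q₁ ¬q₂) qM
      (subst₂ (LinPos α) (proj₁ (affine-modular (∣ Y ∣) (∣ X₁ ∣) (∣ X₂ ∣) (∣ M ∣) vertices (+ 4)))
                         (proj₂ (affine-modular (eIn G Y) (eIn G X₁) (eIn G X₂) (eIn G M) edges (+ 6))) qY)
    where
    k c : Subset (n G) → ℤ
    k X = + ∣ X ∣ - + 4
    c X = + 6 - + eIn G X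

  qPosIn-resp : ∀ α G H (X : Subset (n G)) (Y : Subset (n H)) →
    ∣ X ∣ ≡ ∣ Y ∣ → eIn G X ≡ eIn H Y → qPosIn α G X → qPosIn α H Y
  qPosIn-resp α G H X Y = subst₂ (λ a b → LinPos α (+ a - + 4) (+ 6 - + b))

open import Data.Nat using (_+_; _≤_; _<_; _≤?_)
open import Data.Fin.Subset using (_-_)
open Sum ℕP.+-0-commutativeMonoid using (sum; sum-syntax; ∑-distrib-+; sum-cong-≗; sum-replicate-zero)

∉⇒lookup≡false : ∀ {m} {X : Subset m} {i} → i ∉ X → lookup X i ≡ false
∉⇒lookup≡false {X = X} {i} i∉X = ¬-not (i∉X ∘ VecP.lookup⇒[]= i X)

lookup≡false⇒∉ : ∀ {m} {X : Subset m} {i} → lookup X i ≡ false → i ∉ X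
lookup≡false⇒∉ eq i∈X with trans (sym (VecP.[]=⇒lookup i∈X)) eq
... | ()

x∈p─q⇒x∉q : ∀ {m} (p q : Subset m) {x} → x ∈ p ─ q → x ∉ q
x∈p─q⇒x∉q (_ ∷ p) (true ∷ q)  {zero}  ()
x∈p─q⇒x∉q (_ ∷ p) (false ∷ q) {zero}  here       = λ ()
x∈p─q⇒x∉q (_ ∷ p) (_ ∷ q)     {suc x} (there x∈) = x∈p─q⇒x∉q p q x∈ ∘ drop-there

∉-disjoint : ∀ {m} {p q : Subset m} {x} → p ∩ q ≡ ⊥ → x ∈ p → x ∉ q
∉-disjoint p∩q≡⊥ x∈p x∈q = ∉⊥ (subst (_ ∈_) p∩q≡⊥ (x∈p∩q⁺ (x∈p , x∈q)))

∣p∣<∣q∪p∣ : ∀ {m} (p q : Subset m) {x} → x ∈ q → x ∉ p → ∣ p ∣ < ∣ q ∪ p ∣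
∣p∣<∣q∪p∣ p q x∈q x∉p = p⊂q⇒∣p∣<∣q∣ (q⊆p∪q q p , _ , p⊆p∪q p x∈q , x∉p)

∣p∪q∣+∣p∩q∣≡∣p∣+∣q∣ : ∀ {m} (p q : Subset m) → ∣ p ∪ q ∣ + ∣ p ∩ q ∣ ≡ ∣ p ∣ + ∣ q ∣
∣p∪q∣+∣p∩q∣≡∣p∣+∣q∣ []          []          = refl
∣p∪q∣+∣p∩q∣≡∣p∣+∣q∣ (true ∷ p)  (true ∷ q)  = cong suc (begin
  ∣ p ∪ q ∣ + suc ∣ p ∩ q ∣    ≡⟨ ℕP.+-suc _ _ ⟩
  suc (∣ p ∪ q ∣ + ∣ p ∩ q ∣)  ≡⟨ cong suc (∣p∪q∣+∣p∩q∣≡∣p∣+∣q∣ p q) ⟩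
  suc (∣ p ∣ + ∣ q ∣)          ≡⟨ ℕP.+-suc _ _ ⟨
  ∣ p ∣ + suc ∣ q ∣            ∎)
  where open ≡-Reasoning
∣p∪q∣+∣p∩q∣≡∣p∣+∣q∣ (true ∷ p)  (false ∷ q) = cong suc (∣p∪q∣+∣p∩q∣≡∣p∣+∣q∣ p q)
∣p∪q∣+∣p∩q∣≡∣p∣+∣q∣ (false ∷ p) (true ∷ q)  =
  trans (cong suc (∣p∪q∣+∣p∩q∣≡∣p∣+∣q∣ p q)) (sym (ℕP.+-suc _ _))
∣p∪q∣+∣p∩q∣≡∣p∣+∣q∣ (false ∷ p) (false ∷ q) = ∣p∪q∣+∣p∩q∣≡∣p∣+∣q∣ p q

embed : ∀ {m} (X : Subset m) → Fin ∣ X ∣ → Fin m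
embed (true ∷ X)  zero    = zero
embed (true ∷ X)  (suc a) = suc (embed X a)
embed (false ∷ X) a       = suc (embed X a)

embed-∈ : ∀ {m} (X : Subset m) a → embed X a ∈ X
embed-∈ (true ∷ X)  zero    = here
embed-∈ (true ∷ X)  (suc a) = there (embed-∈ X a)
embed-∈ (false ∷ X) a       = there (embed-∈ X a)

embed-injective : ∀ {m} (X : Subset m) {a b} → embed X a ≡ embed X b → a ≡ b
embed-injective (true ∷ X)  {zero}  {zero}  _  = refl
embed-injective (true ∷ X)  {suc a} {suc b} eq = cong suc (embed-injective X (FinP.suc-injective eq))
embed-injective (false ∷ X)                 eq = embed-injective X (FinP.suc-injective eq)

embed-<ᵇ : ∀ {m} (X : Subset m) a b → (toℕ a <ᵇ toℕ b) ≡ (toℕ (embed X a) <ᵇ toℕ (embed X b))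
embed-<ᵇ (true ∷ X)  zero    zero    = refl
embed-<ᵇ (true ∷ X)  zero    (suc b) = refl
embed-<ᵇ (true ∷ X)  (suc a) zero    = refl
embed-<ᵇ (true ∷ X)  (suc a) (suc b) = embed-<ᵇ X a b
embed-<ᵇ (false ∷ X) a       b       = embed-<ᵇ X a b

embed-onto : ∀ {m} (X : Subset m) {i} → i ∈ X → ∃ λ a → embed X a ≡ i
embed-onto (true ∷ X)  here        = zero , refl
embed-onto (true ∷ X)  (there i∈X) with embed-onto X i∈X
... | a , refl = suc a , refl
embed-onto (false ∷ X) (there i∈X) with embed-onto X i∈X
... | a , refl = a , refl

map-embed-onto : ∀ {m} (X : Subset m) {vs} → All (_∈ X) vs → ∃ λ ws → map (embed X) ws ≡ vs
map-embed-onto X []           = [] , refl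
map-embed-onto X (v∈X ∷ vs∈X) with embed-onto X v∈X | map-embed-onto X vs∈X
... | a , refl | ws , refl = a ∷ ws , refl

image : ∀ {m} (X : Subset m) → Subset ∣ X ∣ → Subset m
image []          C       = []
image (true ∷ X)  (c ∷ C) = c ∷ image X C
image (false ∷ X) C       = false ∷ image X C

lookup-image : ∀ {m} (X : Subset m) C a → lookup (image X C) (embed X a) ≡ lookup C a
lookup-image (true ∷ X)  (c ∷ C) zero    = refl
lookup-image (true ∷ X)  (c ∷ C) (suc a) = lookup-image X C a
lookup-image (false ∷ X) C       a       = lookup-image X C a

image⊆ : ∀ {m} (X : Subset m) C → image X C ⊆ X
image⊆ (true ∷ X)  (true ∷ C) here        = here
image⊆ (true ∷ X)  (c ∷ C)    (there i∈C) = there (image⊆ X C i∈C)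
image⊆ (false ∷ X) C          (there i∈C) = there (image⊆ X C i∈C)

∈-image⁻ : ∀ {m} (X : Subset m) C a → embed X a ∈ image X C → a ∈ C
∈-image⁻ X C a a∈ = VecP.lookup⇒[]= a C (trans (sym (lookup-image X C a)) (VecP.[]=⇒lookup a∈))

∈-image⁺ : ∀ {m} (X : Subset m) C a → a ∈ C → embed X a ∈ image X C
∈-image⁺ X C a a∈ =
  VecP.lookup⇒[]= (embed X a) (image X C) (trans (lookup-image X C a) (VecP.[]=⇒lookup a∈))

-- Sums over Fin m and edge counts

∑-restrict : ∀ {m} (X : Subset m) (f : Fin m → ℕ) → (∀ i → i ∉ X → f i ≡ 0) →
             sum f ≡ sum (f ∘ embed X)
∑-restrict []          f f-zero = refl
∑-restrict (true ∷ X)  f f-zero =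
  cong (f zero +_) (∑-restrict X (f ∘ suc) (λ i i∉X → f-zero (suc i) (i∉X ∘ drop-there)))
∑-restrict (false ∷ X) f f-zero =
  cong₂ _+_ (f-zero zero λ ()) (∑-restrict X (f ∘ suc) (λ i i∉X → f-zero (suc i) (i∉X ∘ drop-there)))

∑∑ : ∀ {m} → (Fin m → Fin m → ℕ) → ℕ
∑∑ {m} f = ∑[ i < m ] ∑[ j < m ] f i j

∑∑-distrib-+ : ∀ {m} (f g : Fin m → Fin m → ℕ) → ∑∑ (λ i j → f i j + g i j) ≡ ∑∑ f + ∑∑ g
∑∑-distrib-+ {m} f g =
  trans (sum-cong-≗ (λ i → ∑-distrib-+ (f i) (g i)))
        (∑-distrib-+ (λ i → ∑[ j < m ] f i j) (λ i → ∑[ j < m ] g i j))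

∑∑-restrict : ∀ {m} (X : Subset m) (f : Fin m → Fin m → ℕ) →
              (∀ i j → i ∉ X → f i j ≡ 0) → (∀ i j → j ∉ X → f i j ≡ 0) →
              ∑∑ f ≡ ∑∑ (λ a b → f (embed X a) (embed X b))
∑∑-restrict {m} X f zeroˡ zeroʳ = begin
  ∑[ i < m ] ∑[ j < m ] f i j
    ≡⟨ ∑-restrict X _ row-zero ⟩
  ∑[ a < ∣ X ∣ ] ∑[ j < m ] f (embed X a) j
    ≡⟨ sum-cong-≗ (λ a → ∑-restrict X _ (zeroʳ (embed X a))) ⟩
  ∑[ a < ∣ X ∣ ] ∑[ b < ∣ X ∣ ] f (embed X a) (embed X b)
    ∎
  where
  open ≡-Reasoning
  row-zero : ∀ i → i ∉ X → ∑[ j < m ] f i j ≡ 0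
  row-zero i i∉X = trans (sum-cong-≗ (λ j → zeroˡ i j i∉X)) (sum-replicate-zero m)

sumˡ-tabulate : ∀ {m} (f : Fin m → ℕ) → sumˡ (tabulate f) ≡ sum f
sumˡ-tabulate {zero}  f = refl
sumˡ-tabulate {suc m} f = cong (f zero +_) (sumˡ-tabulate (f ∘ suc))

sumˡ-allFin : ∀ {m} (f : Fin m → ℕ) → sumˡ (map f (allFin m)) ≡ sum f
sumˡ-allFin f = trans (cong sumˡ (ListP.map-tabulate (λ i → i) f)) (sumˡ-tabulate f)

indicator : Bool → ℕ
indicator b = if b then 1 else 0

edgeIndicator : (G : Graph) → Subset (n G) → Fin (n G) → Fin (n G) → ℕ
edgeIndicator G X i j = indicator ((toℕ i <ᵇ toℕ j) ∧ adj G i j ∧ lookup X i ∧ lookup X j)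

eIn≡∑∑ : (G : Graph) (X : Subset (n G)) → eIn G X ≡ ∑∑ (edgeIndicator G X)
eIn≡∑∑ G X = trans (sumˡ-allFin (λ i → sumˡ (map (edgeIndicator G X i) (allFin (n G)))))
                   (sum-cong-≗ (λ i → sumˡ-allFin (edgeIndicator G X i)))

edgeIndicator-∉ˡ : (G : Graph) (X : Subset (n G)) → ∀ i j → i ∉ X → edgeIndicator G X i j ≡ 0
edgeIndicator-∉ˡ G X i j i∉X
  rewrite ∉⇒lookup≡false i∉X | ∧-zeroʳ (adj G i j) | ∧-zeroʳ (toℕ i <ᵇ toℕ j) = refl

edgeIndicator-∉ʳ : (G : Graph) (X : Subset (n G)) → ∀ i j → j ∉ X → edgeIndicator G X i j ≡ 0
edgeIndicator-∉ʳ G X i j j∉X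
  rewrite ∉⇒lookup≡false j∉X | ∧-zeroʳ (lookup X i) | ∧-zeroʳ (adj G i j) | ∧-zeroʳ (toℕ i <ᵇ toℕ j) = refl

indicator-∪-∩ : ∀ b x y x′ y′ →
  (b ≡ true → x ≡ true → y ≡ false → x′ ≡ false → y′ ≡ true → Empty) →
  (b ≡ true → x ≡ false → y ≡ true → x′ ≡ true → y′ ≡ false → Empty) →
  indicator (b ∧ (x ∨ y) ∧ (x′ ∨ y′)) + indicator (b ∧ (x ∧ y) ∧ (x′ ∧ y′)) ≡
  indicator (b ∧ x ∧ x′) + indicator (b ∧ y ∧ y′)
indicator-∪-∩ false _     _     _     _     _ _ = refl
indicator-∪-∩ true  false false _     _     _ _ = refl
indicator-∪-∩ true  true  true  true  _     _ _ = refl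
indicator-∪-∩ true  true  true  false true  _ _ = refl
indicator-∪-∩ true  true  true  false false _ _ = refl
indicator-∪-∩ true  true  false true  _     _ _ = refl
indicator-∪-∩ true  true  false false false _ _ = refl
indicator-∪-∩ true  true  false false true  h _ = ⊥-elim (h refl refl refl refl refl)
indicator-∪-∩ true  false true  true  true  _ _ = refl
indicator-∪-∩ true  false true  false true  _ _ = refl
indicator-∪-∩ true  false true  false false _ _ = refl
indicator-∪-∩ true  false true  true  false _ h = ⊥-elim (h refl refl refl refl refl)

eIn-∪-∩ : (G : Graph) (p q : Subset (n G)) → (∀ u v → u ∈ p → u ∉ q → v ∈ q → v ∉ p → ¬ Adj G u v) →
          eIn G (p ∪ q) + eIn G (p ∩ q) ≡ eIn G p + eIn G q
eIn-∪-∩ G p q no-cross = begin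
  eIn G (p ∪ q) + eIn G (p ∩ q)             ≡⟨ cong₂ _+_ (eIn≡∑∑ G (p ∪ q)) (eIn≡∑∑ G (p ∩ q)) ⟩
  ∑∑ (E (p ∪ q)) + ∑∑ (E (p ∩ q))           ≡⟨ ∑∑-distrib-+ (E (p ∪ q)) (E (p ∩ q)) ⟨
  ∑∑ (λ i j → E (p ∪ q) i j + E (p ∩ q) i j) ≡⟨ sum-cong-≗ (λ i → sum-cong-≗ (pointwise i)) ⟩
  ∑∑ (λ i j → E p i j + E q i j)             ≡⟨ ∑∑-distrib-+ (E p) (E q) ⟩
  ∑∑ (E p) + ∑∑ (E q)                        ≡⟨ cong₂ _+_ (eIn≡∑∑ G p) (eIn≡∑∑ G q) ⟨
  eIn G p + eIn G q                          ∎
  where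
  open ≡-Reasoning
  E = edgeIndicator G
  pointwise : ∀ i j → E (p ∪ q) i j + E (p ∩ q) i j ≡ E p i j + E q i j
  pointwise i j
    rewrite VecP.lookup-zipWith _∨_ i p q | VecP.lookup-zipWith _∨_ j p q
          | VecP.lookup-zipWith _∧_ i p q | VecP.lookup-zipWith _∧_ j p q
    with toℕ i <ᵇ toℕ j
  ... | false = refl
  ... | true  = indicator-∪-∩ (adj G i j) (lookup p i) (lookup q i) (lookup p j) (lookup q j)
    (λ i~j pᵢ qᵢ pⱼ qⱼ → no-cross i j (VecP.lookup⇒[]= i p pᵢ) (lookup≡false⇒∉ qᵢ)
                                     (VecP.lookup⇒[]= j q qⱼ) (lookup≡false⇒∉ pⱼ) i~j)
    (λ i~j pᵢ qᵢ pⱼ qⱼ → no-cross j i (VecP.lookup⇒[]= j p pⱼ) (lookup≡false⇒∉ qⱼ)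
                                     (VecP.lookup⇒[]= i q qᵢ) (lookup≡false⇒∉ pᵢ) (trans (Graph.sym G j i) i~j))

-- Induced subgraphs

induced : (G : Graph) → Subset (n G) → Graph
induced G X = record
  { n     = ∣ X ∣
  ; adj   = λ a b → adj G (embed X a) (embed X b)
  ; sym   = λ a b → Graph.sym G (embed X a) (embed X b)
  ; irref = λ a → irref G (embed X a)
  }

e-induced : (G : Graph) (X : Subset (n G)) → e (induced G X) ≡ eIn G X
e-induced G X = begin
  e (induced G X)
    ≡⟨ eIn≡∑∑ (induced G X) ⊤ ⟩
  ∑∑ (edgeIndicator (induced G X) ⊤)
    ≡⟨ sum-cong-≗ (λ a → sum-cong-≗ (same-edges a)) ⟩
  ∑∑ (λ a b → edgeIndicator G X (embed X a) (embed X b))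
    ≡⟨ ∑∑-restrict X _ (edgeIndicator-∉ˡ G X) (edgeIndicator-∉ʳ G X) ⟨
  ∑∑ (edgeIndicator G X)
    ≡⟨ eIn≡∑∑ G X ⟨
  eIn G X
    ∎
  where
  open ≡-Reasoning
  same-edges : ∀ a b → edgeIndicator (induced G X) ⊤ a b ≡ edgeIndicator G X (embed X a) (embed X b)
  same-edges a b rewrite VecP.lookup-replicate a true | VecP.lookup-replicate b true
    | VecP.[]=⇒lookup (embed-∈ X a) | VecP.[]=⇒lookup (embed-∈ X b) | embed-<ᵇ X a b = refl

Reach-head : ∀ {G S u v} → Reach G S u v → u ∈ S
Reach-head (here u∈S)     = u∈S
Reach-head (step u∈S _ _) = u∈S

module _ (G : Graph) (X : Subset (n G)) where

  private
    H = induced G X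
    ι = embed X

  Reach-induced : ∀ {S T} → S ⊆ X → (∀ {a} → ι a ∈ S → a ∈ T) →
                  ∀ {x y a b} → Reach G S x y → ι a ≡ x → ι b ≡ y → Reach H T a b
  Reach-induced S⊆X pull (here x∈S) refl eq with embed-injective X eq
  ... | refl = here (pull x∈S)
  Reach-induced S⊆X pull (step x∈S x~w w⇝y) refl refl with embed-onto X (S⊆X (Reach-head w⇝y))
  ... | c , refl = step (pull x∈S) x~w (Reach-induced S⊆X pull w⇝y refl refl)

  module _ (C : Subset ∣ X ∣) where

    ∈-─-image⁺ : ∀ {a} → a ∈ ⊤ ─ C → ι a ∈ X ─ image X C
    ∈-─-image⁺ {a} a∈ = x∈p∧x∉q⇒x∈p─q (embed-∈ X a) (x∈p─q⇒x∉q ⊤ C a∈ ∘ ∈-image⁻ X C a)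

    ∈-─-image⁻ : ∀ {a} → ι a ∈ X ─ image X C → a ∈ ⊤ ─ C
    ∈-─-image⁻ {a} ιa∈ = x∈p∧x∉q⇒x∈p─q ∈⊤ (x∈p─q⇒x∉q X (image X C) ιa∈ ∘ ∈-image⁺ X C a)

    Disconnected-induced : Disconnected H (⊤ ─ C) → Disconnected G (X ─ image X C)
    Disconnected-induced (u , v , u∈ , v∈ , ¬u⇝v) =
      ι u , ι v , ∈-─-image⁺ u∈ , ∈-─-image⁺ v∈ ,
      λ u⇝v → ¬u⇝v (Reach-induced (p─q⊆p X (image X C)) ∈-─-image⁻ u⇝v refl refl)

    IsForest-induced : IsForest H C → IsForest G (image X C)
    IsForest-induced acyclic (vs , unique , 3≤ , vs∈ , linked)
      with map-embed-onto X (All.map (image⊆ X C) vs∈)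
    ... | ws , refl = acyclic
      ( ws
      , UniqueP.map⁻ unique
      , subst (3 ≤_) (ListP.length-map ι ws) 3≤
      , All.map (λ {a} → ∈-image⁻ X C a) (AllP.map⁻ vs∈)
      , LinkedP.map⁻ (subst (Linked (Adj G)) closed linked) )
      where
      closed : map ι ws ++ take 1 (map ι ws) ≡ map ι (ws ++ take 1 ws)
      closed = trans (cong (map ι ws ++_) (ListP.take-map 1 ws)) (sym (ListP.map-++ ι ws (take 1 ws)))

    IsBipartite-induced : IsBipartite H C → IsBipartite G (image X C)
    IsBipartite-induced (colour , proper) = lifted , proper′
      where
      lifted : Fin (n G) → Bool
      lifted = lookup (image X (Vec.tabulate colour))
      lifted-ι : ∀ a → lifted (ι a) ≡ colour a
      lifted-ι a = trans (lookup-image X _ a) (VecP.lookup∘tabulate colour a)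
      proper′ : ∀ u v → u ∈ image X C → v ∈ image X C → Adj G u v → ¬ lifted u ≡ lifted v
      proper′ u v u∈ v∈ u~v with embed-onto X (image⊆ X C u∈) | embed-onto X (image⊆ X C v∈)
      ... | a , refl | b , refl = λ eq → proper a b (∈-image⁻ X C a u∈) (∈-image⁻ X C b v∈) u~v
                                                 (trans (sym (lifted-ι a)) (trans eq (lifted-ι b)))

  InΨ-induced : ∀ Ψ C → InΨ Ψ H C → InΨ Ψ G (image X C)
  InΨ-induced 𝔉 = IsForest-induced
  InΨ-induced 𝔅 = IsBipartite-induced

  HasΨCut-induced : ∀ Ψ → HasΨCut Ψ H → HasΨCutIn Ψ G X
  HasΨCut-induced Ψ (C , (_ , disconnected) , inΨ) =
    image X C , (image⊆ X C , Disconnected-induced C disconnected) , InΨ-induced Ψ C inΨ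

-- Deciding the existence of a Ψ-cut

Unique-lookup-injective : ∀ {A : Set} {xs : List A} → Unique xs →
                          ∀ i j → List.lookup xs i ≡ List.lookup xs j → i ≡ j
Unique-lookup-injective (_  ∷ _) zero    zero    _  = refl
Unique-lookup-injective (x∉ ∷ _) zero    (suc j) eq = ⊥-elim (All.lookup x∉ (∈-lookup j) eq)
Unique-lookup-injective (x∉ ∷ _) (suc i) zero    eq = ⊥-elim (All.lookup x∉ (∈-lookup i) (sym eq))
Unique-lookup-injective (_  ∷ u) (suc i) (suc j) eq = cong suc (Unique-lookup-injective u i j eq)

Unique-length≤ : ∀ {m} {xs : List (Fin m)} → Unique xs → length xs ≤ m
Unique-length≤ u = FinP.injective⇒≤ (Unique-lookup-injective u _ _)

∃-bounded-list? : ∀ {m} k {P : List (Fin m) → Set} → Decidable P → Dec (∃ λ xs → length xs ≤ k × P xs)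
∃-bounded-list? k P? with P? []
... | yes p = yes ([] , z≤n , p)
∃-bounded-list? zero    P? | no ¬p = no λ { ([] , _ , p) → ¬p p }
∃-bounded-list? (suc k) P? | no ¬p with FinP.any? (λ x → ∃-bounded-list? k (P? ∘ (x ∷_)))
... | yes (x , xs , ≤k , p) = yes (x ∷ xs , s≤s ≤k , p)
... | no ¬q = no λ { ([] , _ , p) → ¬p p ; (x ∷ xs , s≤s ≤k , p) → ¬q (x , xs , ≤k , p) }

module _ (G : Graph) where

  Adj? : ∀ u v → Dec (Adj G u v)
  Adj? u v = adj G u v BoolP.≟ true

  Reach-mono : ∀ {S T u v} → S ⊆ T → Reach G S u v → Reach G T u v
  Reach-mono S⊆T (here u∈S)         = here (S⊆T u∈S)
  Reach-mono S⊆T (step u∈S u~w w⇝v) = step (S⊆T u∈S) u~w (Reach-mono S⊆T w⇝v)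

  -- Cutting a path at its last visit to u.
  Reach-split : ∀ {S u x v} → Reach G S x v →
                Reach G (S - u) x v ⊎ u ≡ v ⊎ ∃ λ w → Adj G u w × Reach G (S - u) w v
  Reach-split {u = u} (here {x} x∈S) with x ≟ u
  ... | yes refl = inj₂ (inj₁ refl)
  ... | no x≢u   = inj₁ (here (x∈p∧x≢y⇒x∈p-y x∈S x≢u))
  Reach-split {u = u} (step {x} {w} x∈S x~w w⇝v) with Reach-split {u = u} w⇝v
  ... | inj₂ from-u = inj₂ from-u
  ... | inj₁ w⇝v′ with x ≟ u
  ...   | yes refl = inj₂ (inj₂ (w , x~w , w⇝v′))
  ...   | no x≢u   = inj₁ (step (x∈p∧x≢y⇒x∈p-y x∈S x≢u) x~w w⇝v′)

  -- Recursion on a bound k for ∣ S ∣: removing the start vertex from S decreases it.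
  Reach?ᵏ : ∀ k (S : Subset (n G)) → ∣ S ∣ ≤ k → ∀ u v → Dec (Reach G S u v)
  Reach?ᵏ k S ∣S∣≤k u v with u ∈? S
  ... | no u∉S = no (u∉S ∘ Reach-head)
  ... | yes u∈S with u ≟ v | k | ℕP.<-≤-trans (x∈p⇒∣p-x∣<∣p∣ u∈S) ∣S∣≤k
  ...   | yes refl | _      | _          = yes (here u∈S)
  ...   | no u≢v   | suc k′ | s≤s ∣S-u∣≤k′
    with FinP.any? (λ w → Adj? u w ×-dec Reach?ᵏ k′ (S - u) ∣S-u∣≤k′ w v)
  ...     | yes (w , u~w , w⇝v) = yes (step u∈S u~w (Reach-mono (p─q⊆p S ⁅ u ⁆) w⇝v))
  ...     | no ¬exit = no ([ u∉S-u ∘ Reach-head , [ u≢v , ¬exit ]′ ]′ ∘ Reach-split)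
    where u∉S-u = λ u∈S-u → x∈p─q⇒x∉q S ⁅ u ⁆ u∈S-u (x∈⁅x⁆ u)

  Reach? : ∀ S u v → Dec (Reach G S u v)
  Reach? S = Reach?ᵏ ∣ S ∣ S ℕP.≤-refl

  Disconnected? : ∀ S → Dec (Disconnected G S)
  Disconnected? S = FinP.any? λ u → FinP.any? λ v → (u ∈? S) ×-dec (v ∈? S) ×-dec ¬? (Reach? S u v)

  -- A colouring Fin n → Bool is searched for as the subset it tabulates to.
  IsBipartite? : ∀ X → Dec (IsBipartite G X)
  IsBipartite? X with anySubset? (Proper? ∘ lookup)
    where
    Proper : (Fin (n G) → Bool) → Set
    Proper c = ∀ u v → u ∈ X → v ∈ X → Adj G u v → ¬ c u ≡ c v
    Proper? : ∀ c → Dec (Proper c)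
    Proper? c = FinP.all? λ u → FinP.all? λ v →
      (u ∈? X) →-dec (v ∈? X) →-dec Adj? u v →-dec ¬? (c u BoolP.≟ c v)
  ... | yes (c , proper) = yes (lookup c , proper)
  ... | no ¬proper = no λ (c , proper) → ¬proper (Vec.tabulate c , λ u v u∈X v∈X u~v eq →
          proper u v u∈X v∈X u~v (trans (sym (VecP.lookup∘tabulate c u)) (trans eq (VecP.lookup∘tabulate c v))))

  IsCycleIn : Subset (n G) → List (Fin (n G)) → Set
  IsCycleIn X vs = Unique vs × 3 ≤ length vs × All (_∈ X) vs × Linked (Adj G) (vs ++ take 1 vs)

  HasCycle? : ∀ X → Dec (HasCycle G X)
  HasCycle? X with ∃-bounded-list? (n G) IsCycleIn?
    where
    open import Data.List.Relation.Unary.Unique.DecPropositional (_≟_ {n G}) using (unique?)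
    IsCycleIn? : Decidable (IsCycleIn X)
    IsCycleIn? vs = unique? vs ×-dec (3 ≤? length vs) ×-dec all? (_∈? X) vs ×-dec linked? Adj? (vs ++ take 1 vs)
  ... | yes (vs , _ , cycle) = yes (vs , cycle)
  ... | no ¬cycle = no λ (vs , cycle) → ¬cycle (vs , Unique-length≤ (proj₁ cycle) , cycle)

  InΨ? : ∀ Ψ X → Dec (InΨ Ψ G X)
  InΨ? 𝔉 X = ¬? (HasCycle? X)
  InΨ? 𝔅 X = IsBipartite? X

  HasΨCutIn? : ∀ Ψ Y → Dec (HasΨCutIn Ψ G Y)
  HasΨCutIn? Ψ Y = anySubset? λ C → ((C ⊆? Y) ×-dec Disconnected? (Y ─ C)) ×-dec InΨ? Ψ C

module _ {G : Graph} {M L R : Subset (n G)} where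

  open import Algebra.Solver.IdempotentCommutativeMonoid (∪-idempotentCommutativeMonoid (n G))

  IsSeparation-swap : IsSeparation G M L R → IsSeparation G M R L
  IsSeparation-swap (M∩L≡⊥ , M∩R≡⊥ , L∩R≡⊥ , covers , L≢∅ , R≢∅ , no-edge) =
    M∩R≡⊥ , M∩L≡⊥ , trans (∩-comm R L) L∩R≡⊥ ,
    trans (solve 3 (λ x l r → (x ⊕ r) ⊕ l ⊜ (x ⊕ l) ⊕ r) refl M L R) covers ,
    R≢∅ , L≢∅ , λ u v u∈R v∈L u~v → no-edge v u v∈L u∈R (trans (Graph.sym G v u) u~v)

  sides-∪ : IsSeparation G M L R → (L ∪ M) ∪ (R ∪ M) ≡ ⊤
  sides-∪ (_ , _ , _ , covers , _) =
    trans (solve 3 (λ l x r → (l ⊕ x) ⊕ (r ⊕ x) ⊜ (x ⊕ l) ⊕ r) refl L M R) covers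

  sides-∩ : IsSeparation G M L R → (L ∪ M) ∩ (R ∪ M) ≡ M
  sides-∩ (_ , _ , L∩R≡⊥ , _) = trans (sym (∪-distribʳ-∩ M L R)) (trans (cong (_∪ M) L∩R≡⊥) (∪-identityˡ M))

  sides-∣∣ : IsSeparation G M L R → ∣ ⊤ {n G} ∣ + ∣ M ∣ ≡ ∣ L ∪ M ∣ + ∣ R ∪ M ∣
  sides-∣∣ sep = subst₂ (λ Y Z → ∣ Y ∣ + ∣ Z ∣ ≡ ∣ L ∪ M ∣ + ∣ R ∪ M ∣) (sides-∪ sep) (sides-∩ sep)
                        (∣p∪q∣+∣p∩q∣≡∣p∣+∣q∣ (L ∪ M) (R ∪ M))

  sides-eIn : IsSeparation G M L R → e G + eIn G M ≡ eIn G (L ∪ M) + eIn G (R ∪ M)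
  sides-eIn sep@(_ , _ , _ , _ , _ , _ , no-edge) =
    subst₂ (λ Y Z → eIn G Y + eIn G Z ≡ eIn G (L ∪ M) + eIn G (R ∪ M)) (sides-∪ sep) (sides-∩ sep)
           (eIn-∪-∩ G (L ∪ M) (R ∪ M) (λ u v u∈ u∉ v∈ v∉ → no-edge u v (outside-M u∈ u∉) (outside-M v∈ v∉)))
    where
    outside-M : ∀ {X Y u} → u ∈ X ∪ M → u ∉ Y ∪ M → u ∈ X
    outside-M {X} {Y} u∈X∪M u∉Y∪M =
      [ (λ u∈X → u∈X) , (λ u∈M → ⊥-elim (u∉Y∪M (q⊆p∪q Y M u∈M))) ]′ (x∈p∪q⁻ X M u∈X∪M)

  ∣M∣<∣L∪M∣ : IsSeparation G M L R → ∣ M ∣ < ∣ L ∪ M ∣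
  ∣M∣<∣L∪M∣ (M∩L≡⊥ , _ , _ , _ , (x , x∈L) , _) = ∣p∣<∣q∪p∣ M L x∈L (λ x∈M → ∉-disjoint M∩L≡⊥ x∈M x∈L)

side-bounds : ∀ {G} {M L R : Subset (n G)} → IsSeparation G M L R → 3 ≤ ∣ M ∣ →
              4 ≤ ∣ L ∪ M ∣ × ∣ L ∪ M ∣ < n G
side-bounds {G} {M} {L} {R} sep 3≤∣M∣ =
  ℕP.≤-<-trans 3≤∣M∣ (∣M∣<∣L∪M∣ {G} sep) , subst (∣ L ∪ M ∣ <_) (∣⊤∣≡n (n G)) ∣L∪M∣<∣⊤∣
  where
  open ℕP.≤-Reasoning
  ∣L∪M∣<∣⊤∣ : ∣ L ∪ M ∣ < ∣ ⊤ {n G} ∣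
  ∣L∪M∣<∣⊤∣ = ℕP.+-cancelʳ-< (∣ R ∪ M ∣) (∣ L ∪ M ∣) (∣ ⊤ {n G} ∣) (begin-strict
    ∣ L ∪ M ∣ + ∣ R ∪ M ∣    ≡⟨ sides-∣∣ {G} sep ⟨
    ∣ ⊤ {n G} ∣ + ∣ M ∣       <⟨ ℕP.+-monoʳ-< (∣ ⊤ {n G} ∣) (∣M∣<∣L∪M∣ {G} (IsSeparation-swap {G} sep)) ⟩
    ∣ ⊤ {n G} ∣ + ∣ R ∪ M ∣   ∎)

In𝒢⇒¬qPosIn : ∀ {Ψ α G} → In𝒢 Ψ α G →
              ∀ X → 4 ≤ ∣ X ∣ → ∣ X ∣ < n G → ¬ HasΨCutIn Ψ G X → ¬ qPosIn α G X
In𝒢⇒¬qPosIn {Ψ} {α} {G} (_ , minimal) X 4≤∣X∣ ∣X∣<n ¬cut qX =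
  minimal (induced G X) ∣X∣<n (4≤∣X∣ , qH , ¬cut ∘ HasΨCut-induced G X Ψ)
  where
  qH : qPosIn α (induced G X) ⊤
  qH = qPosIn-resp α G (induced G X) X ⊤ (sym (∣⊤∣≡n ∣ X ∣)) (sym (e-induced G X)) qX

open import Data.Integer using (+_)

lemma4 : (Ψ : Class) (α : ℝ) → ((+ 2) / 1) <ℝ α → α ≤ℝ ((+ 3) / 1) →
    (G : Graph) → In𝒢 Ψ α G →
    (M L R : Subset (n G)) → IsSeparation G M L R → 3 ≤ ∣ M ∣ → qNonnegIn α G M →
    HasΨCutIn Ψ G (L ∪ M) ⊎ HasΨCutIn Ψ G (R ∪ M)
lemma4 Ψ α _ _ G G∈𝒢@((_ , qG , _) , _) M L R sep 3≤∣M∣ qM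
  with HasΨCutIn? G Ψ (L ∪ M) | HasΨCutIn? G Ψ (R ∪ M)
... | yes cutₗ | _        = inj₁ cutₗ
... | no _     | yes cutᵣ = inj₂ cutᵣ
... | no ¬cutₗ | no ¬cutᵣ =
  ⊥-elim (qPosIn-modular α G ⊤ M (L ∪ M) (R ∪ M) (sides-∣∣ {G} sep) (sides-eIn {G} sep) qG
                         (side-¬qPos sep ¬cutₗ) (side-¬qPos (IsSeparation-swap {G} sep) ¬cutᵣ) qM)
  where
  side-¬qPos : ∀ {L R} → IsSeparation G M L R → ¬ HasΨCutIn Ψ G (L ∪ M) → ¬ qPosIn α G (L ∪ M)
  side-¬qPos sep′ with side-bounds {G} sep′ 3≤∣M∣
  ... | 4≤∣L∪M∣ , ∣L∪M∣<n = In𝒢⇒¬qPosIn {Ψ} {α} {G} G∈𝒢 _ 4≤∣L∪M∣ ∣L∪M∣<n
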